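{- Let $(V,\mathcal{B})$ be a $(v,k,\lambda)$-BIBD with replication number $r=\frac{\lambda(v-1)}{k-1}$, equipped with a $0$-ULSE $\ell$-colouring. Then each colour appears in exactly \[\frac{r^2}{\lambda}-\frac{(\ell-1)r^2}{\lambda k}+\frac{(\ell-1)r}{k}\] blocks, and each colour class has size $\frac{v}{\ell}$.
   Context: For positive integers $v,k,\lambda$ with $2\le k<v$, a $(v,k,\lambda)$-BIBD is a pair $(V,\mathcal{B})$ where $V$ is a set of $v$ points and $\mathcal{B}$ is a collection of $k$-element subsets of $V$ (blocks) such that every pair of distinct points lies in exactly $\lambda$ blocks; each point lies in exactly $r=\lambda(v-1)/(k-1)$ blocks. An $\ell$-colouring is a surjective map from $V$ onto a set of $\ell$ colours; the colour class of a colour is the set of points mapped to it. A $0$-ULSE $\ell$-colouring is an $\ell$-colouring such that $(\ell-1)$ divides $k$ and in every block exactly one colour does not appear, while each of the other $\ell-1$ colours appears exactly $\frac{k}{\ell-1}$ times in that block. -}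

module Defs where

open import Data.Nat using (ℕ; zero; suc; _+_; _*_; _∸_)
open import Data.Bool using (Bool; true; false; _∧_; if_then_else_)
open import Data.Fin using (Fin; zero; suc)
open import Data.Fin.Properties using (_≟_)
open import Data.Vec using (lookup)
open import Data.Fin.Subset using (Subset; ∣_∣)
open import Data.Product using (Σ; _×_; ∃)
open import Relation.Binary.PropositionalEquality using (_≡_; _≢_)
open import Relation.Nullary.Decidable using (⌊_⌋)
open import Function.Definitions using (Surjective)
open import Data.Integer using (+_)
open import Data.Rational using (ℚ; _/_; 0ℚ)

count : ∀ {n} → (Fin n → Bool) → ℕ
count {zero}  p = 0
count {suc n} p = (if p zero then 1 else 0) + count (λ i → p (suc i))

_∈ᵇ_ : ∀ {v} → Fin v → Subset v → Bool
x ∈ᵇ B = lookup B x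

-- A (v,k,λ)-BIBD on point set Fin v with b blocks (a family, repeats allowed).
record IsBIBD (v k λ' b : ℕ) (B : Fin b → Subset v) : Set where
  field
    two≤k    : 2 Data.Nat.≤ k
    k<v      : k Data.Nat.< v
    λpos     : 1 Data.Nat.≤ λ'
    blockSize : ∀ i → ∣ B i ∣ ≡ k
    pairs    : ∀ (x y : Fin v) → x ≢ y →
               count (λ i → (x ∈ᵇ B i) ∧ (y ∈ᵇ B i)) ≡ λ'

colourCount : ∀ {v ℓ b} → (B : Fin b → Subset v) → (c : Fin v → Fin ℓ) →
              Fin b → Fin ℓ → ℕ
colourCount B c i m = count (λ x → (x ∈ᵇ B i) ∧ ⌊ c x ≟ m ⌋)

IsColouring : ∀ {v ℓ} → (Fin v → Fin ℓ) → Set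
IsColouring {v} {ℓ} c = Surjective {A = Fin v} {B = Fin ℓ} _≡_ _≡_ c

record Is0ULSE (v k ℓ b : ℕ) (B : Fin b → Subset v) (c : Fin v → Fin ℓ) : Set where
  field
    colouring : IsColouring c
    q         : ℕ
    k≡q*ℓ-1   : k ≡ q * (ℓ ∸ 1)
    perBlock  : ∀ i → Σ (Fin ℓ) λ m →
                  (colourCount B c i m ≡ 0) ×
                  (∀ m' → m' ≢ m → colourCount B c i m' ≡ q)

blocksWithColour : ∀ {v ℓ b} → (Fin b → Subset v) → (Fin v → Fin ℓ) → Fin ℓ → ℕ
blocksWithColour B c m = count (λ i → Data.Bool.not (isZero (colourCount B c i m)))
  where
    isZero : ℕ → Bool
    isZero zero = true
    isZero (suc _) = false

classSize : ∀ {v ℓ} → (Fin v → Fin ℓ) → Fin ℓ → ℕ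
classSize c m = count (λ x → ⌊ c x ≟ m ⌋)

-- rational n/d for natural numbers (d = 0 gives 0; only used with d > 0)
_÷ℕ_ : ℕ → ℕ → ℚ
n ÷ℕ zero  = 0ℚ
n ÷ℕ suc d = (+ n) / suc d

-- Fix a colour m, let s be the size of its class S and n_i the number of points of S
-- in block i.  Counting incidences and pairs inside S gives Σ n_i = r s and
-- Σ n_i² = r s + λ s (s - 1).  In a 0-ULSE colouring each n_i is 0 or q = k/(ℓ-1), so
-- with N the number of blocks meeting S these become q N = r s and q² N = r s + λ s (s - 1).
-- Eliminating N (s ≥ 1 by surjectivity) gives λ s = q r + λ - r, which does not depend
-- on m; hence every class has size v/ℓ, and N = r s / q is the stated formula.
module Submission where

module Counting where

  open import Defs
  open import Data.Nat.Base using (ℕ; zero; suc; _+_; _*_; _∸_; _≤_; _<_; _<ᵇ_; s≤s; >-nonZero)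
  open import Data.Nat.Properties
    using (+-*-semiring; +-identityʳ; *-identityʳ; *-zeroʳ; *-comm; *-assoc;
           +-cancelʳ-≡; *-cancelˡ-≡; *-cancelʳ-≡; m≤m+n)
  open import Data.Nat.Tactic.RingSolver using (solve-∀)
  open import Data.Bool.Base using (Bool; true; false; _∧_; if_then_else_)
  open import Data.Vec.Base using ([]; _∷_)
  open import Data.Fin.Base using (Fin; zero; suc; punchIn)
  open import Data.Fin.Properties using (_≟_; punchInᵢ≢i)
  open import Data.Fin.Subset using (Subset; ∣_∣)
  open import Data.Product.Base using (_×_; _,_; proj₁; proj₂)
  open import Data.Sum.Base using (_⊎_; inj₁; inj₂)
  open import Function.Base using (_∘_)
  open import Relation.Nullary.Decidable using (⌊_⌋; yes; no; isYes≗does; dec-true; dec-false)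
  open import Relation.Binary.PropositionalEquality
    using (_≡_; _≢_; refl; sym; trans; cong; cong₂; subst; subst₂; module ≡-Reasoning)
  open import Algebra.Properties.Semiring.Sum +-*-semiring
    using (sum; sum-syntax; sum-cong-≗; sum-remove; sum-replicate-zero; ∑-comm; ∑-distrib-+;
           *-distribˡ-sum; *-distribʳ-sum)

  open ≡-Reasoning

  [_] : Bool → ℕ
  [ b ] = if b then 1 else 0

  [∧]≡[]*[] : ∀ a b → [ a ∧ b ] ≡ [ a ] * [ b ]
  [∧]≡[]*[] true  true  = refl
  [∧]≡[]*[] true  false = refl
  [∧]≡[]*[] false _     = refl

  []-idem : ∀ b → [ b ] * [ b ] ≡ [ b ]
  []-idem true  = refl
  []-idem false = refl

  [≟]-≡ : ∀ {n} {i j : Fin n} → i ≡ j → [ ⌊ i ≟ j ⌋ ] ≡ 1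
  [≟]-≡ {i = i} {j} i≡j = cong [_] (trans (isYes≗does (i ≟ j)) (dec-true (i ≟ j) i≡j))

  [≟]-≢ : ∀ {n} {i j : Fin n} → i ≢ j → [ ⌊ i ≟ j ⌋ ] ≡ 0
  [≟]-≢ {i = i} {j} i≢j = cong [_] (trans (isYes≗does (i ≟ j)) (dec-false (i ≟ j) i≢j))

  count≡∑ : ∀ {n} (p : Fin n → Bool) → count p ≡ ∑[ i < n ] [ p i ]
  count≡∑ {zero}  p = refl
  count≡∑ {suc n} p = cong ([ p zero ] +_) (count≡∑ (p ∘ suc))

  ∣∣≡∑ : ∀ {n} (S : Subset n) → ∣ S ∣ ≡ ∑[ x < n ] [ x ∈ᵇ S ]
  ∣∣≡∑ []          = refl
  ∣∣≡∑ (true ∷ S)  = cong suc (∣∣≡∑ S)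
  ∣∣≡∑ (false ∷ S) = ∣∣≡∑ S

  ∑-const : ∀ n a → ∑[ i < n ] a ≡ n * a
  ∑-const zero    a = refl
  ∑-const (suc n) a = cong (a +_) (∑-const n a)

  term≤sum : ∀ {n} (f : Fin n → ℕ) i → f i ≤ sum f
  term≤sum {suc n} f i = subst (f i ≤_) (sym (sum-remove {i = i} f)) (m≤m+n (f i) _)

  sum-agree-off : ∀ {n} (f g : Fin n → ℕ) i → (∀ j → j ≢ i → f j ≡ g j) →
                  sum f + g i ≡ sum g + f i
  sum-agree-off {suc n} f g i f≡g = begin
    sum f + g i                      ≡⟨ cong (_+ g i) (sum-remove {i = i} f) ⟩
    f i + sum (f ∘ punchIn i) + g i  ≡⟨ cong (λ t → f i + t + g i) rest ⟩
    f i + sum (g ∘ punchIn i) + g i  ≡⟨ swap (f i) _ (g i) ⟩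
    g i + sum (g ∘ punchIn i) + f i  ≡⟨ cong (_+ f i) (sum-remove {i = i} g) ⟨
    sum g + f i                      ∎
    where
    rest : sum (f ∘ punchIn i) ≡ sum (g ∘ punchIn i)
    rest = sum-cong-≗ (λ j → f≡g (punchIn i j) (punchInᵢ≢i i j))
    swap : ∀ a t c → a + t + c ≡ c + t + a
    swap = solve-∀

  ∑-δ : ∀ {n} (i : Fin n) → ∑[ j < n ] [ ⌊ i ≟ j ⌋ ] ≡ 1
  ∑-δ {n} i = begin
    δ                            ≡⟨ +-identityʳ δ ⟨
    δ + 0                        ≡⟨ sum-agree-off (λ j → [ ⌊ i ≟ j ⌋ ]) (λ _ → 0) i off-i ⟩
    ∑[ j < n ] 0 + [ ⌊ i ≟ i ⌋ ] ≡⟨ cong₂ _+_ (sum-replicate-zero n) ([≟]-≡ refl) ⟩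
    1                            ∎
    where
    δ : ℕ
    δ = ∑[ j < n ] [ ⌊ i ≟ j ⌋ ]
    off-i : ∀ j → j ≢ i → [ ⌊ i ≟ j ⌋ ] ≡ 0
    off-i j j≢i = [≟]-≢ (j≢i ∘ sym)

  sum-*-sum : ∀ {m n} (f : Fin m → ℕ) (g : Fin n → ℕ) →
              sum f * sum g ≡ ∑[ x < m ] ∑[ y < n ] (f x * g y)
  sum-*-sum f g = trans (*-distribʳ-sum (sum g) f) (sum-cong-≗ (λ x → *-distribˡ-sum (f x) g))

  ≡q*[0<ᵇ] : ∀ {q n} → n ≡ 0 ⊎ n ≡ q → n ≡ q * [ 0 <ᵇ n ]
  ≡q*[0<ᵇ] {q}     (inj₁ refl) = sym (*-zeroʳ q)
  ≡q*[0<ᵇ] {zero}  (inj₂ refl) = refl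
  ≡q*[0<ᵇ] {suc q} (inj₂ refl) = sym (*-identityʳ (suc q))

  sum-two-valued : ∀ {n} q (f : Fin n → ℕ) → (∀ i → f i ≡ 0 ⊎ f i ≡ q) →
                   sum f ≡ q * ∑[ i < n ] [ 0 <ᵇ f i ]
                   × ∑[ i < n ] (f i * f i) ≡ q * q * ∑[ i < n ] [ 0 <ᵇ f i ]
  sum-two-valued q f two-valued =
      trans (sum-cong-≗ f≡) (sym (*-distribˡ-sum q (λ i → [ 0 <ᵇ f i ])))
    , trans (sum-cong-≗ f²≡) (sym (*-distribˡ-sum (q * q) (λ i → [ 0 <ᵇ f i ])))
    where
    f≡ : ∀ i → f i ≡ q * [ 0 <ᵇ f i ]
    f≡ i = ≡q*[0<ᵇ] (two-valued i)
    regroup : ∀ q p → q * p * (q * p) ≡ q * q * (p * p)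
    regroup = solve-∀
    f²≡ : ∀ i → f i * f i ≡ q * q * [ 0 <ᵇ f i ]
    f²≡ i = begin
      f i * f i                              ≡⟨ cong₂ _*_ (f≡ i) (f≡ i) ⟩
      q * [ 0 <ᵇ f i ] * (q * [ 0 <ᵇ f i ])  ≡⟨ regroup q [ 0 <ᵇ f i ] ⟩
      q * q * ([ 0 <ᵇ f i ] * [ 0 <ᵇ f i ])  ≡⟨ cong (q * q *_) ([]-idem (0 <ᵇ f i)) ⟩
      q * q * [ 0 <ᵇ f i ]                   ∎

  -- The quadratic form of a J + (d - a) I, with a Σ w² moved left to avoid subtraction.
  quadratic-form : ∀ {n} (Q : Fin n → Fin n → ℕ) {a d} →
                   (∀ {x y} → x ≢ y → Q x y ≡ a) → (∀ x → Q x x ≡ d) → ∀ w →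
                   ∑[ x < n ] ∑[ y < n ] (Q x y * (w x * w y)) + a * ∑[ x < n ] (w x * w x)
                     ≡ a * (sum w * sum w) + d * ∑[ x < n ] (w x * w x)
  quadratic-form {n} Q {a} {d} off diag w = begin
    sum (λ x → sum (Qww x)) + a * sum w²
      ≡⟨ cong (sum (λ x → sum (Qww x)) +_) (*-distribˡ-sum a w²) ⟩
    sum (λ x → sum (Qww x)) + sum (λ x → a * w² x)
      ≡⟨ ∑-distrib-+ (λ x → sum (Qww x)) (λ x → a * w² x) ⟨
    sum (λ x → sum (Qww x) + a * w² x)
      ≡⟨ sum-cong-≗ row ⟩
    sum (λ x → sum (aww x) + d * w² x)
      ≡⟨ ∑-distrib-+ (λ x → sum (aww x)) (λ x → d * w² x) ⟩
    sum (λ x → sum (aww x)) + sum (λ x → d * w² x)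
      ≡⟨ cong₂ _+_ ∑∑aww (*-distribˡ-sum d w²) ⟨
    a * (sum w * sum w) + d * sum w²
      ∎
    where
    w² : Fin n → ℕ
    w² x = w x * w x
    Qww aww : Fin n → Fin n → ℕ
    Qww x y = Q x y * (w x * w y)
    aww x y = a * (w x * w y)
    row : ∀ x → sum (Qww x) + a * w² x ≡ sum (aww x) + d * w² x
    row x = begin
      sum (Qww x) + a * w² x  ≡⟨ sum-agree-off (Qww x) (aww x) x off-x ⟩
      sum (aww x) + Qww x x   ≡⟨ cong (λ t → sum (aww x) + t * w² x) (diag x) ⟩
      sum (aww x) + d * w² x  ∎
      where
      off-x : ∀ y → y ≢ x → Qww x y ≡ aww x y
      off-x y y≢x = cong (_* (w x * w y)) (off (y≢x ∘ sym))
    ∑∑aww : a * (sum w * sum w) ≡ sum (λ x → sum (aww x))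
    ∑∑aww = begin
      a * (sum w * sum w)                      ≡⟨ cong (a *_) (sum-*-sum w w) ⟩
      a * ∑[ x < n ] ∑[ y < n ] (w x * w y)    ≡⟨ *-distribˡ-sum a (λ x → sum (λ y → w x * w y)) ⟩
      ∑[ x < n ] (a * ∑[ y < n ] (w x * w y))  ≡⟨ sum-cong-≗ (λ x → *-distribˡ-sum a (λ y → w x * w y)) ⟩
      sum (λ x → sum (aww x))                  ∎

  replication-unique : ∀ {k v λ' R r} → 2 ≤ k → k < v →
                       R * k + λ' ≡ v * λ' + R → r * (k ∸ 1) ≡ λ' * (v ∸ 1) → R ≡ r
  replication-unique {suc (suc k)} {suc v} {λ'} {R} {r} (s≤s (s≤s _)) (s≤s _) eq hr =
    *-cancelʳ-≡ R r (suc k) (begin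
      R * suc k  ≡⟨ +-cancelʳ-≡ (R + λ') (R * suc k) (v * λ') shifted ⟩
      v * λ'     ≡⟨ *-comm v λ' ⟩
      λ' * v     ≡⟨ hr ⟨
      r * suc k  ∎)
    where
    peel-suc : ∀ R k λ' → R * suc k + (R + λ') ≡ R * suc (suc k) + λ'
    peel-suc = solve-∀
    peel-suc′ : ∀ v λ' R → suc v * λ' + R ≡ v * λ' + (R + λ')
    peel-suc′ = solve-∀
    shifted : R * suc k + (R + λ') ≡ v * λ' + (R + λ')
    shifted = begin
      R * suc k + (R + λ')  ≡⟨ peel-suc R k λ' ⟩
      R * suc (suc k) + λ'  ≡⟨ eq ⟩
      suc v * λ' + R        ≡⟨ peel-suc′ v λ' R ⟩
      v * λ' + (R + λ')     ∎

  module Design {v k λ' b} {B : Fin b → Subset v} (bibd : IsBIBD v k λ' b B) where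
    open IsBIBD bibd

    incidence : Fin v → Fin b → ℕ
    incidence x i = [ x ∈ᵇ B i ]

    replication : Fin v → ℕ
    replication x = count (λ i → x ∈ᵇ B i)

    coincidence : Fin v → Fin v → ℕ
    coincidence x y = ∑[ i < b ] (incidence x i * incidence y i)

    replication≡∑ : ∀ x → replication x ≡ ∑[ i < b ] incidence x i
    replication≡∑ x = count≡∑ (λ i → x ∈ᵇ B i)

    ∑-incidence : ∀ i → ∑[ x < v ] incidence x i ≡ k
    ∑-incidence i = trans (sym (∣∣≡∑ (B i))) (blockSize i)

    coincidence-≢ : ∀ {x y} → x ≢ y → coincidence x y ≡ λ'
    coincidence-≢ {x} {y} x≢y = begin
      coincidence x y
        ≡⟨ sum-cong-≗ (λ i → [∧]≡[]*[] (x ∈ᵇ B i) (y ∈ᵇ B i)) ⟨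
      ∑[ i < b ] [ (x ∈ᵇ B i) ∧ (y ∈ᵇ B i) ]
        ≡⟨ count≡∑ (λ i → (x ∈ᵇ B i) ∧ (y ∈ᵇ B i)) ⟨
      count (λ i → (x ∈ᵇ B i) ∧ (y ∈ᵇ B i))
        ≡⟨ pairs x y x≢y ⟩
      λ'
        ∎

    coincidence-diag : ∀ x → coincidence x x ≡ replication x
    coincidence-diag x = trans (sum-cong-≗ (λ i → []-idem (x ∈ᵇ B i))) (sym (replication≡∑ x))

    ∑-coincidence : ∀ x → ∑[ y < v ] coincidence x y ≡ replication x * k
    ∑-coincidence x = begin
      ∑[ y < v ] ∑[ i < b ] (incidence x i * incidence y i)
        ≡⟨ ∑-comm (λ y i → incidence x i * incidence y i) ⟩
      ∑[ i < b ] ∑[ y < v ] (incidence x i * incidence y i)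
        ≡⟨ sum-cong-≗ (λ i → *-distribˡ-sum (incidence x i) (λ y → incidence y i)) ⟨
      ∑[ i < b ] (incidence x i * ∑[ y < v ] incidence y i)
        ≡⟨ sum-cong-≗ (λ i → cong (incidence x i *_) (∑-incidence i)) ⟩
      ∑[ i < b ] (incidence x i * k)
        ≡⟨ *-distribʳ-sum k (incidence x) ⟨
      ∑[ i < b ] incidence x i * k
        ≡⟨ cong (_* k) (replication≡∑ x) ⟨
      replication x * k
        ∎

    replication-equation : ∀ x → replication x * k + λ' ≡ v * λ' + replication x
    replication-equation x = begin
      replication x * k + λ'           ≡⟨ cong (_+ λ') (∑-coincidence x) ⟨
      ∑[ y < v ] coincidence x y + λ'  ≡⟨ sum-agree-off (coincidence x) (λ _ → λ') x off-x ⟩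
      ∑[ y < v ] λ' + coincidence x x  ≡⟨ cong₂ _+_ (∑-const v λ') (coincidence-diag x) ⟩
      v * λ' + replication x           ∎
      where
      off-x : ∀ y → y ≢ x → coincidence x y ≡ λ'
      off-x y y≢x = coincidence-≢ (y≢x ∘ sym)

    replication≡ : ∀ {r} → r * (k ∸ 1) ≡ λ' * (v ∸ 1) → ∀ x → replication x ≡ r
    replication≡ hr x = replication-unique two≤k k<v (replication-equation x) hr

    hits : (Fin v → ℕ) → Fin b → ℕ
    hits w i = ∑[ x < v ] (incidence x i * w x)

    ∑-hits : ∀ {r} → (∀ x → replication x ≡ r) → ∀ w → ∑[ i < b ] hits w i ≡ r * sum w
    ∑-hits {r} replication≡r w = begin
      ∑[ i < b ] ∑[ x < v ] (incidence x i * w x)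
        ≡⟨ ∑-comm (λ i x → incidence x i * w x) ⟩
      ∑[ x < v ] ∑[ i < b ] (incidence x i * w x)
        ≡⟨ sum-cong-≗ (λ x → *-distribʳ-sum (w x) (incidence x)) ⟨
      ∑[ x < v ] (∑[ i < b ] incidence x i * w x)
        ≡⟨ sum-cong-≗ (λ x → cong (_* w x) (trans (sym (replication≡∑ x)) (replication≡r x))) ⟩
      ∑[ x < v ] (r * w x)
        ≡⟨ *-distribˡ-sum r w ⟨
      r * sum w
        ∎

    ∑-hits²≡quadratic-form : ∀ w → ∑[ i < b ] (hits w i * hits w i)
                                   ≡ ∑[ x < v ] ∑[ y < v ] (coincidence x y * (w x * w y))
    ∑-hits²≡quadratic-form w = begin
      ∑[ i < b ] (hits w i * hits w i)
        ≡⟨ sum-cong-≗ (λ i → sum-*-sum (λ x → incidence x i * w x) (λ y → incidence y i * w y)) ⟩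
      ∑[ i < b ] ∑[ x < v ] ∑[ y < v ] term i x y
        ≡⟨ ∑-comm (λ i x → ∑[ y < v ] term i x y) ⟩
      ∑[ x < v ] ∑[ i < b ] ∑[ y < v ] term i x y
        ≡⟨ sum-cong-≗ (λ x → ∑-comm (λ i y → term i x y)) ⟩
      ∑[ x < v ] ∑[ y < v ] ∑[ i < b ] term i x y
        ≡⟨ sum-cong-≗ (λ x → sum-cong-≗ (λ y → sum-cong-≗ (λ i → term≡ i x y))) ⟩
      ∑[ x < v ] ∑[ y < v ] ∑[ i < b ] (incidence x i * incidence y i * (w x * w y))
        ≡⟨ sum-cong-≗ (λ x → sum-cong-≗ (pull-weights x)) ⟩
      ∑[ x < v ] ∑[ y < v ] (coincidence x y * (w x * w y))
        ∎
      where
      term : Fin b → Fin v → Fin v → ℕ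
      term i x y = incidence x i * w x * (incidence y i * w y)
      regroup : ∀ a p c q → a * p * (c * q) ≡ a * c * (p * q)
      regroup = solve-∀
      term≡ : ∀ i x y → term i x y ≡ incidence x i * incidence y i * (w x * w y)
      term≡ i x y = regroup (incidence x i) (w x) (incidence y i) (w y)
      pull-weights : ∀ x y → ∑[ i < b ] (incidence x i * incidence y i * (w x * w y))
                             ≡ coincidence x y * (w x * w y)
      pull-weights x y = sym (*-distribʳ-sum (w x * w y) (λ i → incidence x i * incidence y i))

    ∑-hits² : ∀ {r} → (∀ x → replication x ≡ r) → ∀ w →
              ∑[ i < b ] (hits w i * hits w i) + λ' * ∑[ x < v ] (w x * w x)
                ≡ λ' * (sum w * sum w) + r * ∑[ x < v ] (w x * w x)
    ∑-hits² {r} replication≡r w =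
      trans (cong (_+ λ' * ∑[ x < v ] (w x * w x)) (∑-hits²≡quadratic-form w))
            (quadratic-form coincidence coincidence-≢ diag w)
      where
      diag : ∀ x → coincidence x x ≡ r
      diag x = trans (coincidence-diag x) (replication≡r x)

  module Colouring {v ℓ} (c : Fin v → Fin ℓ) where

    χ : Fin ℓ → Fin v → ℕ
    χ m x = [ ⌊ c x ≟ m ⌋ ]

    χ-idem : ∀ m x → χ m x * χ m x ≡ χ m x
    χ-idem m x = []-idem ⌊ c x ≟ m ⌋

    classSize≡∑χ : ∀ m → classSize c m ≡ sum (χ m)
    classSize≡∑χ m = count≡∑ (λ x → ⌊ c x ≟ m ⌋)

    ∑-classSize : ∑[ m < ℓ ] classSize c m ≡ v
    ∑-classSize = begin
      ∑[ m < ℓ ] classSize c m     ≡⟨ sum-cong-≗ classSize≡∑χ ⟩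
      ∑[ m < ℓ ] ∑[ x < v ] χ m x  ≡⟨ ∑-comm χ ⟩
      ∑[ x < v ] ∑[ m < ℓ ] χ m x  ≡⟨ sum-cong-≗ (λ x → ∑-δ (c x)) ⟩
      ∑[ x < v ] 1                 ≡⟨ ∑-const v 1 ⟩
      v * 1                        ≡⟨ *-identityʳ v ⟩
      v                            ∎

    classSize-positive : IsColouring c → ∀ m → 1 ≤ classSize c m
    classSize-positive surjective m with surjective m
    ... | x , cx≡m = subst₂ _≤_ ([≟]-≡ (cx≡m refl)) (sym (classSize≡∑χ m)) (term≤sum (χ m) x)

  -- The zero test inside blocksWithColour is local to Defs, so it is reached only by evaluation.
  blocksWithColour≡∑ : ∀ {v ℓ b} (B : Fin b → Subset v) (c : Fin v → Fin ℓ) m →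
                       blocksWithColour B c m ≡ ∑[ i < b ] [ 0 <ᵇ colourCount B c i m ]
  blocksWithColour≡∑ {b = zero}  B c m = refl
  blocksWithColour≡∑ {b = suc b} B c m
    with colourCount B c zero m | blocksWithColour≡∑ (B ∘ suc) c m
  ... | zero  | rest = rest
  ... | suc _ | rest = cong suc rest

  moments⇒class-equation : ∀ q N r s λ' → 1 ≤ s → q * N ≡ r * s →
                           q * q * N + λ' * s ≡ λ' * (s * s) + r * s → q * r + λ' ≡ λ' * s + r
  moments⇒class-equation q N r s@(suc _) λ' _ first second =
    *-cancelˡ-≡ (q * r + λ') (λ' * s + r) s (begin
      s * (q * r + λ')      ≡⟨ expand s q r λ' ⟩
      q * (r * s) + λ' * s  ≡⟨ cong (λ t → q * t + λ' * s) first ⟨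
      q * (q * N) + λ' * s  ≡⟨ cong (_+ λ' * s) (*-assoc q q N) ⟨
      q * q * N + λ' * s    ≡⟨ second ⟩
      λ' * (s * s) + r * s  ≡⟨ factor s r λ' ⟩
      s * (λ' * s + r)      ∎)
    where
    expand : ∀ s q r λ' → s * (q * r + λ') ≡ q * (r * s) + λ' * s
    expand = solve-∀
    factor : ∀ s r λ' → λ' * (s * s) + r * s ≡ s * (λ' * s + r)
    factor = solve-∀

  class-equation⇒blocks-equation : ∀ q L N r s λ' {k} → k ≡ q * L → q * N ≡ r * s →
                                   q * r + λ' ≡ λ' * s + r →
                                   N * (λ' * k) + L * (r * r) ≡ r * r * k + L * r * λ'
  class-equation⇒blocks-equation q L N r s λ' refl first class-equation = begin
    N * (λ' * (q * L)) + L * (r * r)  ≡⟨ regroup N λ' q L r ⟩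
    L * λ' * (q * N) + L * (r * r)    ≡⟨ cong (λ t → L * λ' * t + L * (r * r)) first ⟩
    L * λ' * (r * s) + L * (r * r)    ≡⟨ factor L λ' r s ⟩
    L * r * (λ' * s + r)              ≡⟨ cong (L * r *_) class-equation ⟨
    L * r * (q * r + λ')              ≡⟨ expand L r q λ' ⟩
    r * r * (q * L) + L * r * λ'      ∎
    where
    regroup : ∀ N λ' q L r → N * (λ' * (q * L)) + L * (r * r) ≡ L * λ' * (q * N) + L * (r * r)
    regroup = solve-∀
    factor : ∀ L λ' r s → L * λ' * (r * s) + L * (r * r) ≡ L * r * (λ' * s + r)
    factor = solve-∀
    expand : ∀ L r q λ' → L * r * (q * r + λ') ≡ r * r * (q * L) + L * r * λ'
    expand = solve-∀

  module ZeroULSE {v k λ' b ℓ r} {B : Fin b → Subset v} {c : Fin v → Fin ℓ}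
                  (bibd : IsBIBD v k λ' b B) (hr : r * (k ∸ 1) ≡ λ' * (v ∸ 1))
                  (ulse : Is0ULSE v k ℓ b B c) where
    open IsBIBD bibd
    open Is0ULSE ulse
    open Design bibd
    open Colouring c

    replication≡r : ∀ x → replication x ≡ r
    replication≡r = replication≡ hr

    colourCount-two-valued : ∀ m i → colourCount B c i m ≡ 0 ⊎ colourCount B c i m ≡ q
    colourCount-two-valued m i with perBlock i
    ... | m₀ , absent , present with m ≟ m₀
    ...   | yes refl = inj₁ absent
    ...   | no m≢m₀  = inj₂ (present m m≢m₀)

    colourCount≡hits : ∀ m i → colourCount B c i m ≡ hits (χ m) i
    colourCount≡hits m i = trans (count≡∑ (λ x → (x ∈ᵇ B i) ∧ ⌊ c x ≟ m ⌋))
                                 (sum-cong-≗ (λ x → [∧]≡[]*[] (x ∈ᵇ B i) ⌊ c x ≟ m ⌋))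

    module _ (m : Fin ℓ) where
      private
        s N : ℕ
        s = classSize c m
        N = blocksWithColour B c m
        n : Fin b → ℕ
        n i = colourCount B c i m
        ∑[0<n] ∑χ² : ℕ
        ∑[0<n] = ∑[ i < b ] [ 0 <ᵇ n i ]
        ∑χ² = ∑[ x < v ] (χ m x * χ m x)
        s≡∑χ² : s ≡ ∑χ²
        s≡∑χ² = trans (classSize≡∑χ m) (sym (sum-cong-≗ (χ-idem m)))
        moments-of-n : sum n ≡ q * ∑[0<n] × ∑[ i < b ] (n i * n i) ≡ q * q * ∑[0<n]
        moments-of-n = sum-two-valued q n (colourCount-two-valued m)
        n²≡hits² : ∀ i → n i * n i ≡ hits (χ m) i * hits (χ m) i
        n²≡hits² i = cong₂ _*_ (colourCount≡hits m i) (colourCount≡hits m i)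

      first-moment : q * N ≡ r * s
      first-moment = begin
        q * N                    ≡⟨ cong (q *_) (blocksWithColour≡∑ B c m) ⟩
        q * ∑[0<n]               ≡⟨ proj₁ moments-of-n ⟨
        sum n                    ≡⟨ sum-cong-≗ (colourCount≡hits m) ⟩
        ∑[ i < b ] hits (χ m) i  ≡⟨ ∑-hits replication≡r (χ m) ⟩
        r * sum (χ m)            ≡⟨ cong (r *_) (classSize≡∑χ m) ⟨
        r * s                    ∎

      second-moment : q * q * N + λ' * s ≡ λ' * (s * s) + r * s
      second-moment = begin
        q * q * N + λ' * s
          ≡⟨ cong₂ (λ t u → q * q * t + λ' * u) (blocksWithColour≡∑ B c m) s≡∑χ² ⟩
        q * q * ∑[0<n] + λ' * ∑χ²
          ≡⟨ cong (_+ λ' * ∑χ²) (proj₂ moments-of-n) ⟨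
        ∑[ i < b ] (n i * n i) + λ' * ∑χ²
          ≡⟨ cong (_+ λ' * ∑χ²) (sum-cong-≗ n²≡hits²) ⟩
        ∑[ i < b ] (hits (χ m) i * hits (χ m) i) + λ' * ∑χ²
          ≡⟨ ∑-hits² replication≡r (χ m) ⟩
        λ' * (sum (χ m) * sum (χ m)) + r * ∑χ²
          ≡⟨ cong₂ (λ t u → λ' * (t * t) + r * u) (classSize≡∑χ m) s≡∑χ² ⟨
        λ' * (s * s) + r * s
          ∎

      class-equation : q * r + λ' ≡ λ' * s + r
      class-equation = moments⇒class-equation q N r s λ' (classSize-positive colouring m)
                                              first-moment second-moment

      blocks-equation : N * (λ' * k) + (ℓ ∸ 1) * (r * r) ≡ r * r * k + (ℓ ∸ 1) * r * λ'
      blocks-equation = class-equation⇒blocks-equation q (ℓ ∸ 1) N r s λ' k≡q*ℓ-1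
                                                       first-moment class-equation

    classSize-uniform : ∀ m m′ → classSize c m ≡ classSize c m′
    classSize-uniform m m′ = *-cancelˡ-≡ (classSize c m) (classSize c m′) λ' {{>-nonZero λpos}}
      (+-cancelʳ-≡ r (λ' * classSize c m) (λ' * classSize c m′)
                   (trans (sym (class-equation m)) (class-equation m′)))

    ℓ*classSize≡v : ∀ m → ℓ * classSize c m ≡ v
    ℓ*classSize≡v m = begin
      ℓ * classSize c m           ≡⟨ ∑-const ℓ (classSize c m) ⟨
      ∑[ m′ < ℓ ] classSize c m   ≡⟨ sum-cong-≗ (classSize-uniform m) ⟩
      ∑[ m′ < ℓ ] classSize c m′  ≡⟨ ∑-classSize ⟩
      v                           ∎

module Fractions where

  open import Defs using (_÷ℕ_)
  open import Data.Nat.Base using (suc; _+_; _*_; _≤_; s≤s; z≤n)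
  open import Data.Nat.Properties using (*-identityʳ; *-identityˡ; *-comm; *-mono-≤; *-monoʳ-≤)
  open import Data.Integer.Base as ℤ using (+_)
  open import Data.Integer.Properties using (pos-+; pos-*)
  open import Data.Rational.Base as ℚ using (ℚ; toℚᵘ)
  open import Data.Rational.Properties
    using (toℚᵘ-injective; toℚᵘ-fromℚᵘ; toℚᵘ-homo-+; fromℚᵘ-cong)
  open import Data.Rational.Solver using (module +-*-Solver)
  open import Data.Rational.Unnormalised.Base as ℚᵘ using (mkℚᵘ; *≡*)
  open import Data.Rational.Unnormalised.Properties using (≃-sym; module ≃-Reasoning)
    renaming (+-cong to +ᵘ-cong)
  open import Relation.Binary.PropositionalEquality
    using (_≡_; refl; sym; trans; cong; cong₂; module ≡-Reasoning)

  ÷ℕ-cross : ∀ a b {d e} → 1 ≤ d → 1 ≤ e → a * e ≡ b * d → a ÷ℕ d ≡ b ÷ℕ e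
  ÷ℕ-cross a b {suc d} {suc e} (s≤s z≤n) (s≤s z≤n) ae≡bd =
    fromℚᵘ-cong {mkℚᵘ (+ a) d} {mkℚᵘ (+ b) e} (*≡* (begin
      + a ℤ.* + suc e  ≡⟨ pos-* a (suc e) ⟨
      + (a * suc e)    ≡⟨ cong +_ ae≡bd ⟩
      + (b * suc d)    ≡⟨ pos-* b (suc d) ⟩
      + b ℤ.* + suc d  ∎))
    where open ≡-Reasoning

  ÷ℕ-exact : ∀ a b {d} → 1 ≤ d → d * a ≡ b → a ÷ℕ 1 ≡ b ÷ℕ d
  ÷ℕ-exact a b {d} 1≤d da≡b =
    ÷ℕ-cross a b (s≤s z≤n) 1≤d (trans (*-comm a d) (trans da≡b (sym (*-identityʳ b))))

  ÷ℕ-+ : ∀ a b {d e} → 1 ≤ d → 1 ≤ e → a ÷ℕ d ℚ.+ b ÷ℕ e ≡ (a * e + b * d) ÷ℕ (d * e)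
  ÷ℕ-+ a b {suc d} {suc e} (s≤s z≤n) (s≤s z≤n) = toℚᵘ-injective (begin
      toℚᵘ (a ÷ℕ suc d ℚ.+ b ÷ℕ suc e)
        ≈⟨ toℚᵘ-homo-+ (a ÷ℕ suc d) (b ÷ℕ suc e) ⟩
      toℚᵘ (a ÷ℕ suc d) ℚᵘ.+ toℚᵘ (b ÷ℕ suc e)
        ≈⟨ +ᵘ-cong (toℚᵘ-fromℚᵘ (mkℚᵘ (+ a) d)) (toℚᵘ-fromℚᵘ (mkℚᵘ (+ b) e)) ⟩
      mkℚᵘ (+ a) d ℚᵘ.+ mkℚᵘ (+ b) e
        ≡⟨ cong (λ n → mkℚᵘ n (e + d * suc e)) numerator ⟩
      mkℚᵘ (+ (a * suc e + b * suc d)) (e + d * suc e)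
        ≈⟨ ≃-sym (toℚᵘ-fromℚᵘ (mkℚᵘ (+ (a * suc e + b * suc d)) (e + d * suc e))) ⟩
      toℚᵘ ((a * suc e + b * suc d) ÷ℕ (suc d * suc e))
        ∎)
    where
    open ≃-Reasoning
    numerator : + a ℤ.* + suc e ℤ.+ + b ℤ.* + suc d ≡ + (a * suc e + b * suc d)
    numerator = sym (trans (pos-+ (a * suc e) (b * suc d))
                           (cong₂ ℤ._+_ (pos-* a (suc e)) (pos-* b (suc d))))

  x+b≡a+c⇒x≡a-b+c : ∀ (x a b c : ℚ) → x ℚ.+ b ≡ a ℚ.+ c → x ≡ a ℚ.- b ℚ.+ c
  x+b≡a+c⇒x≡a-b+c x a b c eq = begin
    x              ≡⟨ solve 2 (λ x b → x := x :+ b :- b) refl x b ⟩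
    x ℚ.+ b ℚ.- b  ≡⟨ cong (ℚ._- b) eq ⟩
    a ℚ.+ c ℚ.- b  ≡⟨ solve 3 (λ a b c → a :+ c :- b := a :- b :+ c) refl a b c ⟩
    a ℚ.- b ℚ.+ c  ∎
    where
    open ≡-Reasoning
    open +-*-Solver

  clear-denominators : ∀ x y z w {d e} → 1 ≤ d → 1 ≤ e → x * (d * e) + y ≡ z * e + w * d →
                       x ÷ℕ 1 ≡ z ÷ℕ d ℚ.- y ÷ℕ (d * e) ℚ.+ w ÷ℕ e
  clear-denominators x y z w {d} {e} 1≤d 1≤e eq =
    x+b≡a+c⇒x≡a-b+c (x ÷ℕ 1) (z ÷ℕ d) (y ÷ℕ (d * e)) (w ÷ℕ e) (begin
      x ÷ℕ 1 ℚ.+ y ÷ℕ (d * e)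
        ≡⟨ ÷ℕ-+ x y (s≤s z≤n) 1≤de ⟩
      (x * (d * e) + y * 1) ÷ℕ (1 * (d * e))
        ≡⟨ ÷ℕ-cross (x * (d * e) + y * 1) (z * e + w * d) (*-monoʳ-≤ 1 1≤de) 1≤de cross ⟩
      (z * e + w * d) ÷ℕ (d * e)
        ≡⟨ ÷ℕ-+ z w 1≤d 1≤e ⟨
      z ÷ℕ d ℚ.+ w ÷ℕ e
        ∎)
    where
    open ≡-Reasoning
    1≤de : 1 ≤ d * e
    1≤de = *-mono-≤ 1≤d 1≤e
    cross : (x * (d * e) + y * 1) * (d * e) ≡ (z * e + w * d) * (1 * (d * e))
    cross = cong₂ _*_ (trans (cong (λ t → x * (d * e) + t) (*-identityʳ y)) eq)
                      (sym (*-identityˡ (d * e)))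

open import Defs
open import Data.Nat using (ℕ; _*_; _∸_)
open import Data.Fin using (Fin)
open import Data.Fin.Subset using (Subset)
open import Data.Rational using (ℚ; _+_; _-_)
open import Relation.Binary.PropositionalEquality using (_≡_)
open import Data.Product using (_×_; _,_)
open import Data.Nat.Base using (>-nonZero⁻¹)
open import Data.Nat.Properties using (<⇒≤)
open import Data.Fin.Properties using (nonZeroIndex)
open Counting using (module ZeroULSE)
open Fractions using (clear-denominators; ÷ℕ-exact)

lemma3p4 : (v k λ' r b ℓ : ℕ) (B : Fin b → Subset v) (c : Fin v → Fin ℓ) →
    IsBIBD v k λ' b B →
    r * (k ∸ 1) ≡ λ' * (v ∸ 1) →
    Is0ULSE v k ℓ b B c →
    (∀ (m : Fin ℓ) →
      (blocksWithColour B c m ÷ℕ 1)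
        ≡ (((r * r) ÷ℕ λ') - (((ℓ ∸ 1) * (r * r)) ÷ℕ (λ' * k)))
            + (((ℓ ∸ 1) * r) ÷ℕ k)
      × (classSize c m ÷ℕ 1) ≡ (v ÷ℕ ℓ))
lemma3p4 v k λ' r b ℓ B c bibd hr ulse m =
    clear-denominators (blocksWithColour B c m) ((ℓ ∸ 1) * (r * r)) (r * r) ((ℓ ∸ 1) * r)
                       λpos (<⇒≤ two≤k) (blocks-equation m)
  , ÷ℕ-exact (classSize c m) v (>-nonZero⁻¹ ℓ {{nonZeroIndex m}}) (ℓ*classSize≡v m)
  where
  open IsBIBD bibd
  open ZeroULSE {r = r} bibd hr ulse
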